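{- Let $\alpha$ be an ordinal with $0<\alpha<\varepsilon_0$ and let $x\in\mathbb{N}$ with $x\geq N\alpha$. Then $P_x(\alpha)=\max\{\beta : \beta<\alpha,\ N\beta\leq x\}$.
   Context: Ordinals below $\varepsilon_0$ are represented by terms in Cantor normal form $\alpha=\omega^{\alpha_1}\cdot c_1+\cdots+\omega^{\alpha_p}\cdot c_p$ with $\alpha>\alpha_1>\cdots>\alpha_p$ and $0<c_1,\dots,c_p<\omega$ ($\alpha=0$ iff $p=0$). The norm is defined recursively by $N\alpha=\max\{c_1,\dots,c_p,N\alpha_1,\dots,N\alpha_p\}$ (so $N0=0$). An ordinal $\alpha>0$ is a successor if its last exponent is $0$, i.e. $\alpha=\alpha'+1$, and a limit otherwise; a limit $\lambda$ can be written $\gamma+\omega^\beta$ with $\beta$ the last exponent of its CNF. Fundamental sequences for limits are defined by $(\gamma+\omega^{\beta+1})(x)=\gamma+\omega^{\beta}\cdot(x+1)$ and $(\gamma+\omega^{\lambda})(x)=\gamma+\omega^{\lambda(x)}$ for $\lambda$ a limit. The predecessor $P_x(\alpha)$ of $\alpha>0$ at $x\in\mathbb{N}$ is defined by $P_x(\alpha+1)=\alpha$ and $P_x(\lambda)=P_x(\lambda(x))$ for limit $\lambda$. -}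

module Defs where

open import Data.Nat using (ℕ; zero; suc; _⊔_) renaming (_<_ to _<ℕ_)
open import Data.Sum using (_⊎_)
open import Relation.Binary.PropositionalEquality using (_≡_)

-- Ordinal notations below ε₀ as Cantor-normal-form terms.
-- ω^ a ·suc c + b  denotes  ω^a · (c+1) + b.
data OT : Set where
  𝟎 : OT
  ω^_·suc_+_ : OT → ℕ → OT → OT

infixr 30 ω^_·suc_+_

infix 4 _<ₒ_ _≤ₒ_
data _<ₒ_ : OT → OT → Set where
  <-zero : ∀ {a c b} → 𝟎 <ₒ ω^ a ·suc c + b
  <-exp  : ∀ {a c b a' c' b'} → a <ₒ a' → ω^ a ·suc c + b <ₒ ω^ a' ·suc c' + b'
  <-coef : ∀ {a c b c' b'} → c <ℕ c' → ω^ a ·suc c + b <ₒ ω^ a ·suc c' + b'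
  <-tail : ∀ {a c b b'} → b <ₒ b' → ω^ a ·suc c + b <ₒ ω^ a ·suc c + b'

_≤ₒ_ : OT → OT → Set
α ≤ₒ β = α <ₒ β ⊎ α ≡ β

-- Cantor normal form: exponents strictly decreasing
-- (b < ω^a ⇔ b = 0 or the leading exponent of b is < a).
data CNF : OT → Set where
  cnf-𝟎 : CNF 𝟎
  cnf-ω : ∀ {a c b} → CNF a → CNF b → b <ₒ ω^ a ·suc 0 + 𝟎 → CNF (ω^ a ·suc c + b)

N : OT → ℕ
N 𝟎 = 0
N (ω^ a ·suc c + b) = suc c ⊔ (N a ⊔ N b)

-- IsSucc α α'  :  α = α' + 1
data IsSucc : OT → OT → Set where
  succ-one  : IsSucc (ω^ 𝟎 ·suc 0 + 𝟎) 𝟎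
  succ-coef : ∀ {c} → IsSucc (ω^ 𝟎 ·suc (suc c) + 𝟎) (ω^ 𝟎 ·suc c + 𝟎)
  succ-tail : ∀ {a c b b'} → IsSucc b b' → IsSucc (ω^ a ·suc c + b) (ω^ a ·suc c + b')

addHead : OT → ℕ → OT → OT
addHead a zero t = t
addHead a (suc c) t = ω^ a ·suc c + t

-- FS λ x μ  :  λ is a limit and λ(x) = μ.
-- Writing λ = γ + ω^β:
--   (γ + ω^(β'+1))(x) = γ + ω^β' · (x+1),   (γ + ω^β)(x) = γ + ω^(β(x)) for β limit.
data FS : OT → ℕ → OT → Set where
  fs-succ : ∀ {a a' c x} → IsSucc a a' →
            FS (ω^ a ·suc c + 𝟎) x (addHead a c (ω^ a' ·suc x + 𝟎))
  fs-lim  : ∀ {a a'' c x} → FS a x a'' →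
            FS (ω^ a ·suc c + 𝟎) x (addHead a c (ω^ a'' ·suc 0 + 𝟎))
  fs-tail : ∀ {a c b b' x} → FS b x b' →
            FS (ω^ a ·suc c + b) x (ω^ a ·suc c + b')

-- Pred x α β  :  P_x(α) = β.
-- P_x(α+1) = α,  P_x(λ) = P_x(λ(x)).
data Pred (x : ℕ) : OT → OT → Set where
  pred-succ : ∀ {α α'} → IsSucc α α' → Pred x α α'
  pred-lim  : ∀ {λ' μ β} → FS λ' x μ → Pred x μ β → Pred x λ' β

-- Both P_x(α) and "the largest β < α with N β ≤ x" satisfy
-- the same recursion on the Cantor normal form of α:
--   * α = ω^a·c + b with b > 0:    change only the tail, giving ω^a·c + P_x(b);
--   * α = ω^a·(c+1):               ω^a·c + P_x(ω^a);
--   * α = ω^0 = 1:                 0;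
--   * α = ω^a with a > 0:          ω^p·x + P_x(ω^p), where p = P_x(a).  The theorem follows by well-founded induction;
-- the case x = 0 is vacuous since every α > 0 has norm ≥ 1.
module Submission where

open import Defs
open import Data.Nat using (ℕ; _≤_; zero; suc; _⊔_; z≤n; s≤s; s≤s⁻¹) renaming (_<_ to _<ℕ_)
open import Data.Nat.Properties using (m⊔n≤o⇒m≤o; m⊔n≤o⇒n≤o; ⊔-lub; m≤n⇒m<n∨m≡n; ≤-refl; ≤-trans; n≤1+n; <-trans)
open import Data.Nat.Induction using (<-wellFounded)
open import Induction.WellFounded using (Acc; acc)
open import Data.Product using (Σ; _×_; _,_)
open import Data.Sum using (inj₁; inj₂)
open import Relation.Binary.PropositionalEquality using (refl)

<ₒ-trans : ∀ {a b c} → a <ₒ b → b <ₒ c → a <ₒ c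
<ₒ-trans <-zero     (<-exp q)  = <-zero
<ₒ-trans <-zero     (<-coef q) = <-zero
<ₒ-trans <-zero     (<-tail q) = <-zero
<ₒ-trans (<-exp p)  (<-exp q)  = <-exp (<ₒ-trans p q)
<ₒ-trans (<-exp p)  (<-coef q) = <-exp p
<ₒ-trans (<-exp p)  (<-tail q) = <-exp p
<ₒ-trans (<-coef p) (<-exp q)  = <-exp q
<ₒ-trans (<-coef p) (<-coef q) = <-coef (<-trans p q)
<ₒ-trans (<-coef p) (<-tail q) = <-coef p
<ₒ-trans (<-tail p) (<-exp q)  = <-exp q
<ₒ-trans (<-tail p) (<-coef q) = <-coef q
<ₒ-trans (<-tail p) (<-tail q) = <-tail (<ₒ-trans p q)

below-ω^ : ∀ {e c b y} → y <ₒ ω^ e ·suc 0 + 𝟎 → y <ₒ ω^ e ·suc c + b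
below-ω^ <-zero     = <-zero
below-ω^ (<-exp p)  = <-exp p
below-ω^ (<-coef ())
below-ω^ (<-tail ())

tail-below : ∀ {a c b} → b <ₒ ω^ a ·suc 0 + 𝟎 → b <ₒ ω^ a ·suc c + b
tail-below = below-ω^

<ω^self : ∀ {a} → CNF a → a <ₒ ω^ a ·suc 0 + 𝟎
<ω^self cnf-𝟎           = <-zero
<ω^self (cnf-ω ca _ _) = <-exp (below-ω^ (<ω^self ca))

_⊏_ : OT → OT → Set
β ⊏ α = CNF β × β <ₒ α

Accessible : OT → Set
Accessible = Acc _⊏_

acc-𝟎 : Accessible 𝟎
acc-𝟎 = acc λ { (_ , ()) }

-- ω^a·(n+1) + b is accessible when a, b and n are: a normal form below it
-- either has a smaller exponent, a smaller coefficient, or a smaller tail.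
-- The mutual recursion is a lexicographic induction on (a, n, b); the tail
-- of a smaller term is again smaller, which handles its own tail.
mutual
  acc-term : ∀ {a} → Accessible a → ∀ n → Acc _<ℕ_ n → ∀ {b} → Accessible b →
             Accessible (ω^ a ·suc n + b)
  acc-term wa n an wb = acc λ { (cγ , γ<) → acc-below wa n an wb _ cγ γ< }

  acc-below : ∀ {a b} → Accessible a → ∀ n → Acc _<ℕ_ n → Accessible b →
              ∀ γ → CNF γ → γ <ₒ ω^ a ·suc n + b → Accessible γ
  acc-below wa n an wb 𝟎 _ _ = acc-𝟎
  acc-below (acc ra) n an wb (ω^ a' ·suc n' + b') (cnf-ω ca' cb' b'<) (<-exp p) =
    acc-term (ra (ca' , p)) n' (<-wellFounded n')
      (acc-below (acc ra) n an wb b' cb' (<ₒ-trans (tail-below {c = n'} b'<) (<-exp p)))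
  acc-below wa n (acc rn) wb (ω^ a' ·suc n' + b') (cnf-ω ca' cb' b'<) (<-coef p) =
    acc-term wa n' (rn p)
      (acc-below wa n (acc rn) wb b' cb' (<ₒ-trans (tail-below {c = n'} b'<) (<-coef p)))
  acc-below wa n an (acc rb) (ω^ a' ·suc n' + b') (cnf-ω ca' cb' b'<) (<-tail p) =
    acc-term wa n an (rb (cb' , p))

cnf-accessible : ∀ α → CNF α → Accessible α
cnf-accessible 𝟎 _ = acc-𝟎
cnf-accessible (ω^ a ·suc c + b) (cnf-ω ca cb _) =
  acc-term (cnf-accessible a ca) c (<-wellFounded c) (cnf-accessible b cb)

N-coef : ∀ a c b {x} → N (ω^ a ·suc c + b) ≤ x → suc c ≤ x
N-coef a c b h = m⊔n≤o⇒m≤o (suc c) (N a ⊔ N b) h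

N-exp : ∀ a c b {x} → N (ω^ a ·suc c + b) ≤ x → N a ≤ x
N-exp a c b h = m⊔n≤o⇒m≤o (N a) (N b) (m⊔n≤o⇒n≤o (suc c) (N a ⊔ N b) h)

N-tail : ∀ a c b {x} → N (ω^ a ·suc c + b) ≤ x → N b ≤ x
N-tail a c b h = m⊔n≤o⇒n≤o (N a) (N b) (m⊔n≤o⇒n≤o (suc c) (N a ⊔ N b) h)

N-ω^ : ∀ a {x'} → N a ≤ suc x' → N (ω^ a ·suc 0 + 𝟎) ≤ suc x'
N-ω^ a h = ⊔-lub (s≤s z≤n) (⊔-lub h z≤n)

-- P_x(ω^a·c + b) = ω^a·c + P_x(b): fundamental sequences act on the tail.
pred-tail : ∀ {x a c b β} → Pred x b β → Pred x (ω^ a ·suc c + b) (ω^ a ·suc c + β)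
pred-tail (pred-succ s)  = pred-succ (succ-tail s)
pred-tail (pred-lim f p) = pred-lim (fs-tail f) (pred-tail p)

pred-coef : ∀ {x a β} c → Pred x (ω^ a ·suc 0 + 𝟎) β → Pred x (ω^ a ·suc c + 𝟎) (addHead a c β)
pred-coef zero    p                         = p
pred-coef (suc c) (pred-succ succ-one)      = pred-succ succ-coef
pred-coef (suc c) (pred-succ (succ-tail ()))
pred-coef (suc c) (pred-lim (fs-succ s) p)  = pred-lim (fs-succ s) (pred-tail p)
pred-coef (suc c) (pred-lim (fs-lim f) p)   = pred-lim (fs-lim f) (pred-tail p)
pred-coef (suc c) (pred-lim (fs-tail ()) p)

-- P_x(ω^a) = ω^p·x + P_x(ω^p) where p = P_x(a): following the fundamental
-- sequences of ω^a mirrors those of a until the exponent a' + 1 is reached,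
-- and then ω^(a'+1)(x) = ω^a'·(x+1).
pred-ω^ : ∀ {x a p q} → Pred x a p → Pred x (ω^ p ·suc 0 + 𝟎) q →
          Pred x (ω^ a ·suc 0 + 𝟎) (addHead p x q)
pred-ω^ {x} (pred-succ s)  h = pred-lim (fs-succ s) (pred-coef x h)
pred-ω^     (pred-lim f r) h = pred-lim (fs-lim f) (pred-ω^ r h)

IsMax : ℕ → OT → OT → Set
IsMax x α β = CNF β × β <ₒ α × N β ≤ x ×
  ((γ : OT) → CNF γ → γ <ₒ α → N γ ≤ x → γ ≤ₒ β)

max-one : ∀ {x} → IsMax x (ω^ 𝟎 ·suc 0 + 𝟎) 𝟎
max-one = cnf-𝟎 , <-zero , z≤n , largest
  where
  largest : (γ : OT) → CNF γ → γ <ₒ ω^ 𝟎 ·suc 0 + 𝟎 → N γ ≤ _ → γ ≤ₒ 𝟎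
  largest _ _ <-zero      _ = inj₂ refl
  largest _ _ (<-exp ())  _
  largest _ _ (<-coef ()) _
  largest _ _ (<-tail ()) _

-- If β is the maximum below b, then ω^a·c + β is the maximum below ω^a·c + b:
-- anything smaller either differs before the tail, or has a tail below b.
max-tail : ∀ {x a c b β} → CNF (ω^ a ·suc c + b) → N (ω^ a ·suc c + b) ≤ x →
           IsMax x b β → IsMax x (ω^ a ·suc c + b) (ω^ a ·suc c + β)
max-tail {x} {a} {c} {b} {β} (cnf-ω ca cb b<) n (cβ , β<b , nβ , maxβ) =
  cnf-ω ca cβ (<ₒ-trans β<b b<) , <-tail β<b ,
  ⊔-lub (N-coef a c b n) (⊔-lub (N-exp a c b n) nβ) , largest
  where
  largest : (γ : OT) → CNF γ → γ <ₒ ω^ a ·suc c + b → N γ ≤ x → γ ≤ₒ ω^ a ·suc c + β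
  largest _ _ <-zero     _ = inj₁ <-zero
  largest _ _ (<-exp p)  _ = inj₁ (<-exp p)
  largest _ _ (<-coef p) _ = inj₁ (<-coef p)
  largest (ω^ _ ·suc _ + b') (cnf-ω _ cb' _) (<-tail p) nγ
    with maxβ b' cb' p (N-tail a c b' nγ)
  ... | inj₁ q    = inj₁ (<-tail q)
  ... | inj₂ refl = inj₂ refl

max-coef : ∀ {x a c β} → CNF (ω^ a ·suc (suc c) + 𝟎) → N (ω^ a ·suc (suc c) + 𝟎) ≤ x →
           IsMax x (ω^ a ·suc 0 + 𝟎) β → IsMax x (ω^ a ·suc (suc c) + 𝟎) (ω^ a ·suc c + β)
max-coef {x} {a} {c} {β} (cnf-ω ca _ _) n (cβ , β< , nβ , maxβ) =
  cnf-ω ca cβ β< , <-coef ≤-refl ,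
  ⊔-lub (≤-trans (n≤1+n _) (N-coef a (suc c) 𝟎 n)) (⊔-lub (N-exp a (suc c) 𝟎 n) nβ) , largest
  where
  largest : (γ : OT) → CNF γ → γ <ₒ ω^ a ·suc (suc c) + 𝟎 → N γ ≤ x → γ ≤ₒ ω^ a ·suc c + β
  largest _ _ <-zero      _ = inj₁ <-zero
  largest _ _ (<-exp p)   _ = inj₁ (<-exp p)
  largest _ _ (<-tail ()) _
  largest (ω^ _ ·suc c' + b') (cnf-ω _ cb' b'<) (<-coef (s≤s c'≤c)) nγ
    with m≤n⇒m<n∨m≡n c'≤c
  ... | inj₁ c'<c = inj₁ (<-coef c'<c)
  ... | inj₂ refl with maxβ b' cb' b'< (N-tail a c b' nγ)
  ...   | inj₁ q    = inj₁ (<-tail q)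
  ...   | inj₂ refl = inj₂ refl

-- If p is the maximum below a and q the maximum below ω^p, then ω^p·x + q is
-- the maximum below ω^a: a smaller γ = ω^e·c' + b' has e ≤ p, then c' ≤ x
-- by the norm bound, and finally b' ≤ q.
max-ω^ : ∀ {x' a p q} → IsMax (suc x') a p → IsMax (suc x') (ω^ p ·suc 0 + 𝟎) q →
         IsMax (suc x') (ω^ a ·suc 0 + 𝟎) (ω^ p ·suc x' + q)
max-ω^ {x'} {a} {p} {q} (cp , p<a , np , maxp) (cq , q< , nq , maxq) =
  cnf-ω cp cq q< , <-exp p<a , ⊔-lub ≤-refl (⊔-lub np nq) , largest
  where
  largest : (γ : OT) → CNF γ → γ <ₒ ω^ a ·suc 0 + 𝟎 → N γ ≤ suc x' → γ ≤ₒ ω^ p ·suc x' + q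
  largest _ _ <-zero      _ = inj₁ <-zero
  largest _ _ (<-coef ()) _
  largest _ _ (<-tail ()) _
  largest (ω^ e ·suc c' + b') (cnf-ω ce cb' b'<) (<-exp e<a) nγ
    with maxp e ce e<a (N-exp e c' b' nγ)
  ... | inj₁ e<p = inj₁ (<-exp e<p)
  ... | inj₂ refl with m≤n⇒m<n∨m≡n (s≤s⁻¹ (N-coef p c' b' nγ))
  ...   | inj₁ c'<x' = inj₁ (<-coef c'<x')
  ...   | inj₂ refl with maxq b' cb' b'< (N-tail p x' b' nγ)
  ...     | inj₁ r    = inj₁ (<-tail r)
  ...     | inj₂ refl = inj₂ refl

pred-is-max : ∀ x' α → Accessible α → CNF α → 𝟎 <ₒ α → N α ≤ suc x' →
              Σ OT (λ β → Pred (suc x') α β × IsMax (suc x') α β)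
pred-is-max x' 𝟎 _ _ () _
pred-is-max x' (ω^ a ·suc c + b@(ω^ _ ·suc _ + _)) (acc rs) cα@(cnf-ω _ cb b<) _ n
  with pred-is-max x' b (rs (cb , tail-below b<)) cb <-zero (N-tail a c b n)
... | β , pβ , maxβ = ω^ a ·suc c + β , pred-tail pβ , max-tail cα n maxβ
pred-is-max x' (ω^ a ·suc (suc c) + 𝟎) (acc rs) cα@(cnf-ω ca _ _) _ n
  with pred-is-max x' (ω^ a ·suc 0 + 𝟎) (rs (cω^a , <-coef (s≤s z≤n))) cω^a <-zero
         (N-ω^ a (N-exp a (suc c) 𝟎 n))
  where cω^a = cnf-ω ca cnf-𝟎 <-zero
... | β , pβ , maxβ = ω^ a ·suc c + β , pred-coef (suc c) pβ , max-coef cα n maxβ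
pred-is-max x' (ω^ 𝟎 ·suc 0 + 𝟎) _ _ _ _ = 𝟎 , pred-succ succ-one , max-one
pred-is-max x' (ω^ a@(ω^ _ ·suc _ + _) ·suc 0 + 𝟎) (acc rs) (cnf-ω ca _ _) _ n
  with pred-is-max x' a (rs (ca , <ω^self ca)) ca <-zero (N-exp a 0 𝟎 n)
... | p , pp , maxp@(cp , p<a , np , _)
  with pred-is-max x' (ω^ p ·suc 0 + 𝟎) (rs (cω^p , <-exp p<a)) cω^p <-zero (N-ω^ p np)
  where cω^p = cnf-ω cp cnf-𝟎 <-zero
... | q , pq , maxq = ω^ p ·suc x' + q , pred-ω^ pp pq , max-ω^ maxp maxq

lemma3p1 : (α : OT) → CNF α → 𝟎 <ₒ α → (x : ℕ) → N α ≤ x →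
    Σ OT (λ β → Pred x α β × CNF β × β <ₒ α × N β ≤ x ×
    ((γ : OT) → CNF γ → γ <ₒ α → N γ ≤ x → γ ≤ₒ β))
lemma3p1 𝟎 _ () _ _
lemma3p1 (ω^ a ·suc c + b) _ _ zero n with N-coef a c b n
... | ()
lemma3p1 α cα 0<α (suc x') n = pred-is-max x' α (cnf-accessible α cα) cα 0<α n
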